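{- Let $n$ be a positive integer and $k \in \{0,1,\dots,n\}$. Let $\mathcal{Q}_{n,k} \subset \mathbb{R}^n$ be the polytope defined by $x_i \ge 0$ for $1 \le i \le n$, $x_i \le 1$ for $1 \le i \le k$, and $x_1 + \cdots + x_n \le n$. For $0 \le i \le n$ let $h_i$ be the number of points of $\mathcal{Q}_{n,k} \cap \mathbb{N}^n$ having exactly $i$ nonzero coordinates, and let $h(\tau_{n,k},t) = \sum_{i=0}^n h_i t^i$. Then $h(\tau_{n,k},t)$ is $\gamma$-positive, i.e. there exist nonnegative integers $\gamma_0,\dots,\gamma_{\lfloor n/2\rfloor}$ with $h(\tau_{n,k},t) = \sum_{i=0}^{\lfloor n/2 \rfloor} \gamma_i t^i(1+t)^{n-2i}$. In particular, $h(\tau_{n,k},t)$ is palindromic and unimodal.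
   Context: $\mathbb{N} = \{0,1,2,\dots\}$. A polynomial $\sum_{i=0}^n h_i t^i$ is palindromic if $h_i = h_{n-i}$ for all $i$, and unimodal if its coefficient sequence weakly increases and then weakly decreases. The notation $\tau_{n,k}$ refers to the arbor (rooted tree on blocks of a partition of $[n]$) with root $\{k+1,\dots,n\}$ and leaves $\{1\},\dots,\{k\}$; its arbor polytope is $\mathcal{Q}_{n,k}$. -}

module Defs where

open import Data.Nat using (ℕ; zero; suc; _+_; _*_; _∸_; _≤_; _<_; _≤ᵇ_; _≡ᵇ_; _/_)
open import Data.Nat.Combinatorics using (_C_)
open import Data.Bool using (Bool; true; false; _∧_; not; if_then_else_)
open import Data.Fin using (Fin; toℕ)
open import Data.Vec using (Vec; []; _∷_)
open import Data.List using (List; []; _∷_; [_]; map; concatMap; upTo; length; filterᵇ)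
open import Data.Product using (Σ; _×_)
open import Relation.Binary.PropositionalEquality using (_≡_)

boxVecs : (n b : ℕ) → List (Vec ℕ n)
boxVecs zero    b = [ [] ]
boxVecs (suc n) b = concatMap (λ v → map (λ a → a ∷ v) (upTo (suc b))) (boxVecs n b)

vsum : ∀ {n} → Vec ℕ n → ℕ
vsum []       = 0
vsum (a ∷ v) = a + vsum v

nonzeros : ∀ {n} → Vec ℕ n → ℕ
nonzeros []       = 0
nonzeros (a ∷ v) = (if a ≡ᵇ 0 then 0 else 1) + nonzeros v

-- coordinates with (1-based) index ≤ k are ≤ 1; `j` is the 0-based index of the head
lowBounded : ∀ {n} → ℕ → ℕ → Vec ℕ n → Bool
lowBounded k j []       = true
lowBounded k j (a ∷ v) = (if suc j ≤ᵇ k then a ≤ᵇ 1 else true) ∧ lowBounded k (suc j) v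

inQ : (n k : ℕ) → Vec ℕ n → Bool
inQ n k x = lowBounded k 0 x ∧ (vsum x ≤ᵇ n)

-- h_i = #{ x ∈ Q_{n,k} ∩ ℕ^n : x has exactly i nonzero coordinates }.
-- Every lattice point of Q_{n,k} lies in {0,…,n}^n (coordinates are ≤ the sum ≤ n),
-- so enumerating that box is exhaustive.
hCoeff : (n k i : ℕ) → ℕ
hCoeff n k i = length (filterᵇ (λ x → inQ n k x ∧ (nonzeros x ≡ᵇ i)) (boxVecs n n))

ΣFin : (m : ℕ) → (Fin m → ℕ) → ℕ
ΣFin zero    f = 0
ΣFin (suc m) f = f Fin.zero + ΣFin m (λ j → f (Fin.suc j))

-- coefficient of t^i in t^j (1+t)^(n-2j)
gammaBasisCoeff : (n j i : ℕ) → ℕ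
gammaBasisCoeff n j i = if j ≤ᵇ i then (n ∸ (2 * j)) C (i ∸ j) else 0

GammaPositive : (n : ℕ) → (ℕ → ℕ) → Set
GammaPositive n h = Σ (Fin (suc (n / 2)) → ℕ) λ γ →
  ∀ (i : ℕ) → h i ≡ ΣFin (suc (n / 2)) (λ j → γ j * gammaBasisCoeff n (toℕ j) i)

Palindromic : (n : ℕ) → (ℕ → ℕ) → Set
Palindromic n h = ∀ i → i ≤ n → h i ≡ h (n ∸ i)

Unimodal : (n : ℕ) → (ℕ → ℕ) → Set
Unimodal n h = Σ ℕ λ m → m ≤ n ×
  ((∀ i → i < m → h i ≤ h (suc i)) × (∀ i → m ≤ i → i < n → h (suc i) ≤ h i))

-- Sorting the lattice points by which of the k coordinates bounded by 1 equal 1 gives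
-- h_i = Σ_a C(k,a) C(r,i−a) C(n−a,i−a) with r = n − k, because positive integer vectors of
-- length l with sum ≤ m are counted by C(m,l). Two rounds of Vandermonde convolution and
-- trinomial revision C(n,a) C(n−a,c) = C(n,a+c) C(a+c,a) turn this into
-- h_i = Σ_j C(r,j) C(n−j,j) C(n−2j,i−j), the coefficient of t^i in Σ_j γ_j t^j (1+t)^(n−2j)
-- with γ_j = C(r,j) C(n−j,j). Every t^j (1+t)^(n−2j) with 2j ≤ n is palindromic of degree n
-- and unimodal with peak at ⌊n/2⌋, and nonnegative combinations keep both properties.
module Submission where

open import Defs
open import Data.Bool using (Bool; true; false; _∧_; T; T?)
open import Data.Bool.Properties using (∧-zeroʳ)
open import Data.Fin using (Fin; toℕ)
open import Data.Fin.Properties using (toℕ<n; toℕ≤pred[n])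
open import Data.List using (List; []; _∷_; [_]; _++_; map; concatMap; upTo; applyUpTo; length; filterᵇ)
open import Data.List.Properties using (filter-++; filter-≐; filter-none; length-++; map-applyUpTo)
open import Data.List.Relation.Unary.All using (universal)
open import Data.Nat
open import Data.Nat.Combinatorics
open import Data.Nat.DivMod using (m≡m%n+[m/n]*n; m%n<n; m/n*n≤m; m/n≤m; m/n*n≡m)
open import Data.Nat.Properties
open import Algebra.Properties.Semiring.Sum +-*-semiring
  using (sum-syntax; sum-cong-≗; sum-replicate-zero; ∑-distrib-+; ∑-comm; *-distribˡ-sum)
open import Data.Nat.Tactic.RingSolver using (solve-∀)
open import Data.Product using (Σ; _×_; _,_)
open import Data.Vec using (Vec; []; _∷_)
open import Function using (_∘_; id)
open import Relation.Binary.PropositionalEquality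
  using (_≡_; refl; sym; trans; cong; cong₂; subst; subst₂; module ≡-Reasoning)
open import Relation.Nullary using (yes; no; contradiction)
open import Relation.Nullary.Reflects using (ofʸ; ofⁿ)
open ≡-Reasoning

private
  variable
    A B : Set

-- Sums over initial segments of ℕ

∑< : ℕ → (ℕ → ℕ) → ℕ
∑< N f = ∑[ j < N ] f (toℕ j)

∑<-cong : ∀ N {f g} → (∀ a → a < N → f a ≡ g a) → ∑< N f ≡ ∑< N g
∑<-cong N f≡g = sum-cong-≗ {N} (λ j → f≡g (toℕ j) (toℕ<n j))

∑<-zero : ∀ N {f} → (∀ a → f a ≡ 0) → ∑< N f ≡ 0
∑<-zero N f≡0 = trans (sum-cong-≗ {N} (f≡0 ∘ toℕ)) (sum-replicate-zero N)

∑<-distrib-+ : ∀ N f g → ∑< N (λ a → f a + g a) ≡ ∑< N f + ∑< N g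
∑<-distrib-+ N f g = ∑-distrib-+ {N} (f ∘ toℕ) (g ∘ toℕ)

*-distribˡ-∑< : ∀ N x f → x * ∑< N f ≡ ∑< N (λ a → x * f a)
*-distribˡ-∑< N x f = *-distribˡ-sum {N} x (f ∘ toℕ)

∑<-comm : ∀ M N (f : ℕ → ℕ → ℕ) → ∑< M (λ a → ∑< N (f a)) ≡ ∑< N (λ b → ∑< M (λ a → f a b))
∑<-comm M N f = ∑-comm {M} {N} (λ a b → f (toℕ a) (toℕ b))

∑<-+-vanishing : ∀ N K f → (∀ a → N ≤ a → f a ≡ 0) → ∑< (N + K) f ≡ ∑< N f
∑<-+-vanishing zero    K f f≡0 = ∑<-zero K (λ a → f≡0 a z≤n)
∑<-+-vanishing (suc N) K f f≡0 =
  cong (f 0 +_) (∑<-+-vanishing N K (f ∘ suc) (λ a N≤a → f≡0 (suc a) (s≤s N≤a)))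

∑<-support : ∀ M N {f} → (∀ a → M ≤ a → f a ≡ 0) → (∀ a → N ≤ a → f a ≡ 0) → ∑< M f ≡ ∑< N f
∑<-support M N {f} vanishM vanishN = begin
  ∑< M f        ≡⟨ ∑<-+-vanishing M N f vanishM ⟨
  ∑< (M + N) f  ≡⟨ cong (λ L → ∑< L f) (+-comm M N) ⟩
  ∑< (N + M) f  ≡⟨ ∑<-+-vanishing N M f vanishN ⟩
  ∑< N f        ∎

∑<-triangle : ∀ i (g : ℕ → ℕ → ℕ) →
  ∑< (suc i) (λ a → ∑< (suc (i ∸ a)) (λ c → g a (a + c)))
    ≡ ∑< (suc i) (λ p → ∑< (suc p) (λ a → g a p))
∑<-triangle zero    g = refl
∑<-triangle (suc i) g = begin
  ∑< (suc (suc i)) (g 0) + ∑< (suc i) (λ a → ∑< (suc (i ∸ a)) (λ c → g (suc a) (suc (a + c))))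
    ≡⟨ cong (∑< (suc (suc i)) (g 0) +_) (∑<-triangle i (λ a p → g (suc a) (suc p))) ⟩
  g 0 0 + row + triangle
    ≡⟨ regroup (g 0 0) row triangle ⟩
  g 0 0 + 0 + (row + triangle)
    ≡⟨ cong (g 0 0 + 0 +_) (∑<-distrib-+ (suc i) (g 0 ∘ suc) (λ p → ∑< (suc p) (λ a → g (suc a) (suc p)))) ⟨
  ∑< (suc (suc i)) (λ p → ∑< (suc p) (λ a → g a p)) ∎
  where
  row triangle : ℕ
  row      = ∑< (suc i) (λ p → g 0 (suc p))
  triangle = ∑< (suc i) (λ p → ∑< (suc p) (λ a → g (suc a) (suc p)))
  regroup : ∀ x y z → x + y + z ≡ x + 0 + (y + z)
  regroup = solve-∀

-- Binomial identities

pascal : ∀ n k → suc n C suc k ≡ n C k + n C suc k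
pascal n k = sym (nCk+nC[k+1]≡[n+1]C[k+1] n k)

[m+n]Cm≡[m+n]Cn : ∀ m n → (m + n) C m ≡ (m + n) C n
[m+n]Cm≡[m+n]Cn m n = trans (nCk≡nC[n∸k] (m≤m+n m n)) (cong ((m + n) C_) (m+n∸m≡n m n))

nCk*k!*[n∸k]!≡n! : ∀ {n k} → k ≤ n → (n C k) * (k ! * (n ∸ k) !) ≡ n !
nCk*k!*[n∸k]!≡n! {n} {k} k≤n = trans
  (cong (_* (k ! * (n ∸ k) !)) (nCk≡n!/k![n-k]! k≤n))
  (m/n*n≡m {{k !* (n ∸ k) !≢0}} (k![n∸k]!∣n! k≤n))

[m+n]Cm*m!*n!≡[m+n]! : ∀ m n → ((m + n) C m) * (m ! * n !) ≡ (m + n) !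
[m+n]Cm*m!*n!≡[m+n]! m n =
  subst (λ x → ((m + n) C m) * (m ! * x !) ≡ (m + n) !) (m+n∸m≡n m n) (nCk*k!*[n∸k]!≡n! (m≤m+n m n))

vandermonde : ∀ m n s → ∑< (suc s) (λ c → (m C c) * (n C (s ∸ c))) ≡ (m + n) C s
vandermonde zero    n s = trans (cong₂ _+_ (*-identityˡ (n C s)) (∑<-zero s (λ _ → refl))) (+-identityʳ _)
vandermonde (suc m) n zero    = refl
vandermonde (suc m) n (suc s) = begin
  1 * (n C suc s) + ∑< (suc s) (λ c → (suc m C suc c) * (n C (s ∸ c)))
    ≡⟨ cong (1 * (n C suc s) +_) (trans (∑<-cong (suc s) (λ c _ → pascal-term c)) (∑<-distrib-+ (suc s) lower upper)) ⟩
  1 * (n C suc s) + (∑< (suc s) lower + ∑< (suc s) upper)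
    ≡⟨ regroup (1 * (n C suc s)) (∑< (suc s) lower) (∑< (suc s) upper) ⟩
  ∑< (suc s) lower + (1 * (n C suc s) + ∑< (suc s) upper)
    ≡⟨ cong₂ _+_ (vandermonde m n s) (vandermonde m n (suc s)) ⟩
  (m + n) C s + (m + n) C suc s
    ≡⟨ pascal (m + n) s ⟨
  (suc m + n) C suc s ∎
  where
  lower upper : ℕ → ℕ
  lower c = (m C c) * (n C (s ∸ c))
  upper c = (m C suc c) * (n C (s ∸ c))
  pascal-term : ∀ c → (suc m C suc c) * (n C (s ∸ c)) ≡ lower c + upper c
  pascal-term c = trans (cong (_* (n C (s ∸ c))) (pascal m c)) (*-distribʳ-+ (n C (s ∸ c)) (m C c) (m C suc c))
  regroup : ∀ x y z → x + (y + z) ≡ y + (x + z)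
  regroup = solve-∀

∑mCj*iCj≡[m+i]Ci : ∀ m i → ∑< (suc i) (λ j → (m C j) * (i C j)) ≡ (m + i) C i
∑mCj*iCj≡[m+i]Ci m i = trans
  (∑<-cong (suc i) (λ j j≤i → cong ((m C j) *_) (nCk≡nC[n∸k] (s≤s⁻¹ j≤i))))
  (vandermonde m i i)

trinomial-revision : ∀ a c e → ((a + (c + e)) C a) * ((c + e) C c) ≡ ((a + c + e) C (a + c)) * ((a + c) C a)
trinomial-revision a c e = *-cancelʳ-≡ _ _ (a ! * (c ! * e !)) {{m*n≢0 _ _ {{a !≢0}} {{c !* e !≢0}}}} (begin
  ((a + (c + e)) C a) * ((c + e) C c) * (a ! * (c ! * e !))
    ≡⟨ shuffleˡ ((a + (c + e)) C a) ((c + e) C c) (a !) (c !) (e !) ⟩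
  ((a + (c + e)) C a) * (a ! * (((c + e) C c) * (c ! * e !)))
    ≡⟨ cong (λ x → ((a + (c + e)) C a) * (a ! * x)) ([m+n]Cm*m!*n!≡[m+n]! c e) ⟩
  ((a + (c + e)) C a) * (a ! * (c + e) !)
    ≡⟨ [m+n]Cm*m!*n!≡[m+n]! a (c + e) ⟩
  (a + (c + e)) !
    ≡⟨ cong _! (+-assoc a c e) ⟨
  (a + c + e) !
    ≡⟨ [m+n]Cm*m!*n!≡[m+n]! (a + c) e ⟨
  ((a + c + e) C (a + c)) * ((a + c) ! * e !)
    ≡⟨ cong (λ x → ((a + c + e) C (a + c)) * (x * e !)) ([m+n]Cm*m!*n!≡[m+n]! a c) ⟨
  ((a + c + e) C (a + c)) * (((a + c) C a) * (a ! * c !) * e !)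
    ≡⟨ shuffleʳ ((a + c + e) C (a + c)) ((a + c) C a) (a !) (c !) (e !) ⟨
  ((a + c + e) C (a + c)) * ((a + c) C a) * (a ! * (c ! * e !)) ∎)
  where
  shuffleˡ : ∀ x y p q r → x * y * (p * (q * r)) ≡ x * (p * (y * (q * r)))
  shuffleˡ = solve-∀
  shuffleʳ : ∀ x y p q r → x * y * (p * (q * r)) ≡ x * (y * (p * q) * r)
  shuffleʳ = solve-∀

nCa*[n∸a]Cc≡nC[a+c]*[a+c]Ca : ∀ n a c → (n C a) * ((n ∸ a) C c) ≡ (n C (a + c)) * ((a + c) C a)
nCa*[n∸a]Cc≡nC[a+c]*[a+c]Ca n a c with a + c ≤? n
... | yes a+c≤n = begin
  (n C a) * ((n ∸ a) C c)
    ≡⟨ cong₂ (λ x y → (x C a) * (y C c)) n≡ n∸a≡ ⟨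
  ((a + (c + e)) C a) * ((c + e) C c)
    ≡⟨ trinomial-revision a c e ⟩
  ((a + c + e) C (a + c)) * ((a + c) C a)
    ≡⟨ cong (λ x → (x C (a + c)) * ((a + c) C a)) (trans (+-assoc a c e) n≡) ⟩
  (n C (a + c)) * ((a + c) C a) ∎
  where
  e : ℕ
  e = n ∸ (a + c)
  n≡ : a + (c + e) ≡ n
  n≡ = trans (sym (+-assoc a c e)) (m+[n∸m]≡n a+c≤n)
  n∸a≡ : c + e ≡ n ∸ a
  n∸a≡ = trans (sym (m+n∸m≡n a (c + e))) (cong (_∸ a) n≡)
... | no a+c≰n with a ≤? n
...   | yes a≤n = begin
  (n C a) * ((n ∸ a) C c)  ≡⟨ cong ((n C a) *_) (k>n⇒nCk≡0 n∸a<c) ⟩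
  (n C a) * 0              ≡⟨ *-zeroʳ (n C a) ⟩
  0                        ≡⟨ cong (_* ((a + c) C a)) (k>n⇒nCk≡0 (≰⇒> a+c≰n)) ⟨
  (n C (a + c)) * ((a + c) C a) ∎
  where
  n∸a<c : n ∸ a < c
  n∸a<c = +-cancelˡ-< a (n ∸ a) c (subst (_< a + c) (sym (m+[n∸m]≡n a≤n)) (≰⇒> a+c≰n))
...   | no a≰n = trans
  (cong (_* ((n ∸ a) C c)) (k>n⇒nCk≡0 (≰⇒> a≰n)))
  (cong (_* ((a + c) C a)) (sym (k>n⇒nCk≡0 (≰⇒> a+c≰n))))

nCj*[n∸j]Cs≡nCs*[n∸s]Cj : ∀ n j s → (n C j) * ((n ∸ j) C s) ≡ (n C s) * ((n ∸ s) C j)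
nCj*[n∸j]Cs≡nCs*[n∸s]Cj n j s = begin
  (n C j) * ((n ∸ j) C s)        ≡⟨ nCa*[n∸a]Cc≡nC[a+c]*[a+c]Ca n j s ⟩
  (n C (j + s)) * ((j + s) C j)  ≡⟨ cong ((n C (j + s)) *_) ([m+n]Cm≡[m+n]Cn j s) ⟩
  (n C (j + s)) * ((j + s) C s)  ≡⟨ cong (λ x → (n C x) * (x C s)) (+-comm j s) ⟩
  (n C (s + j)) * ((s + j) C s)  ≡⟨ nCa*[n∸a]Cc≡nC[a+c]*[a+c]Ca n s j ⟨
  (n C s) * ((n ∸ s) C j)        ∎

[1+k]*nC[1+k]≡[n∸k]*nCk : ∀ {n k} → k < n → suc k * (n C suc k) ≡ (n ∸ k) * (n C k)
[1+k]*nC[1+k]≡[n∸k]*nCk {n} {k} k<n = *-cancelʳ-≡ _ _ (k ! * (n ∸ suc k) !) {{k !* (n ∸ suc k) !≢0}} (begin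
  suc k * (n C suc k) * (k ! * (n ∸ suc k) !)
    ≡⟨ shuffleˡ (suc k) (n C suc k) (k !) ((n ∸ suc k) !) ⟩
  (n C suc k) * (suc k ! * (n ∸ suc k) !)
    ≡⟨ nCk*k!*[n∸k]!≡n! k<n ⟩
  n !
    ≡⟨ nCk*k!*[n∸k]!≡n! (<⇒≤ k<n) ⟨
  (n C k) * (k ! * (n ∸ k) !)
    ≡⟨ cong (λ x → (n C k) * (k ! * x)) ([n-k]*[n-k-1]!≡[n-k]! k<n) ⟨
  (n C k) * (k ! * ((n ∸ k) * (n ∸ suc k) !))
    ≡⟨ shuffleʳ (n ∸ k) (n C k) (k !) ((n ∸ suc k) !) ⟨
  (n ∸ k) * (n C k) * (k ! * (n ∸ suc k) !) ∎)
  where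
  shuffleˡ : ∀ x y p q → x * y * (p * q) ≡ y * (x * p * q)
  shuffleˡ = solve-∀
  shuffleʳ : ∀ x y p q → x * y * (p * q) ≡ y * (p * (x * q))
  shuffleʳ = solve-∀

nCk≤nC[1+k] : ∀ {n k} → 2 * k < n → n C k ≤ n C suc k
nCk≤nC[1+k] {n} {k} 2k<n = *-cancelˡ-≤ (suc k) (≤-trans
  (*-monoˡ-≤ (n C k) 1+k≤n∸k)
  (≤-reflexive (sym ([1+k]*nC[1+k]≡[n∸k]*nCk (≤-trans (s≤s (m≤m+n k (k + 0))) 2k<n)))))
  where
  1+k≤n∸k : suc k ≤ n ∸ k
  1+k≤n∸k = m+n≤o⇒m≤o∸n (suc k) (subst (_≤ n) (cong suc (cong (k +_) (+-identityʳ k))) 2k<n)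

∑<[m∸1+a]Ci≡mC[1+i] : ∀ m i → ∑< m (λ a → (m ∸ suc a) C i) ≡ m C suc i
∑<[m∸1+a]Ci≡mC[1+i] zero    i = refl
∑<[m∸1+a]Ci≡mC[1+i] (suc m) i = trans (cong (m C i +_) (∑<[m∸1+a]Ci≡mC[1+i] m i)) (sym (pascal m i))

-- γ-positive coefficient sequences are palindromic and unimodal

m≤n/2⇒2m≤n : ∀ {m n} → m ≤ n / 2 → 2 * m ≤ n
m≤n/2⇒2m≤n {m} {n} m≤n/2 =
  ≤-trans (≤-reflexive (*-comm 2 m)) (≤-trans (*-monoˡ-≤ 2 m≤n/2) (m/n*n≤m n 2))

n/2<m⇒n<2m : ∀ {m n} → n / 2 < m → n < 2 * m
n/2<m⇒n<2m {m} {n} n/2<m = subst (_< 2 * m) (sym (m≡m%n+[m/n]*n n 2)) (<-≤-trans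
  (+-monoˡ-< (n / 2 * 2) (m%n<n n 2))
  (≤-trans (*-monoˡ-≤ 2 n/2<m) (≤-reflexive (*-comm m 2))))

n<2m⇒n∸m<m : ∀ {m n} → n < 2 * m → n ∸ m < m
n<2m⇒n∸m<m {suc m} {n} n<2m =
  m<n+o⇒m∸n<o n (suc m) (subst (n <_) (cong (suc m +_) (+-identityʳ (suc m))) n<2m)

2[n∸m]<n : ∀ {m n} → n < 2 * m → m ≤ n → 2 * (n ∸ m) < n
2[n∸m]<n {m} {n} n<2m m≤n = subst (2 * d <_) (m∸n+n≡m m≤n) (+-monoʳ-< d (subst (_< m) (sym (+-identityʳ d)) d<m))
  where
  d : ℕ
  d = n ∸ m
  d<m : d < m
  d<m = +-cancelʳ-< m d m (subst₂ _<_ (sym (m∸n+n≡m m≤n)) (cong (m +_) (+-identityʳ m)) n<2m)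

gammaBasisCoeff-≥ : ∀ n j {i} → j ≤ i → gammaBasisCoeff n j i ≡ (n ∸ 2 * j) C (i ∸ j)
gammaBasisCoeff-≥ n j {i} j≤i with j ≤ᵇ i | ≤ᵇ-reflects-≤ j i
... | true  | _       = refl
... | false | ofⁿ j≰i = contradiction j≤i j≰i

gammaBasisCoeff-< : ∀ n j {i} → i < j → gammaBasisCoeff n j i ≡ 0
gammaBasisCoeff-< n j {i} i<j with j ≤ᵇ i | ≤ᵇ-reflects-≤ j i
... | true  | ofʸ j≤i = contradiction j≤i (<⇒≱ i<j)
... | false | _       = refl

gammaBasisCoeff-vanishes : ∀ n j {i} → 2 * j ≤ n → n < i + j → gammaBasisCoeff n j i ≡ 0
gammaBasisCoeff-vanishes n j {i} 2j≤n n<i+j with i <? j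
... | yes i<j = gammaBasisCoeff-< n j i<j
... | no i≮j  = trans (gammaBasisCoeff-≥ n j j≤i) (k>n⇒nCk≡0 n∸2j<i∸j)
  where
  j≤i : j ≤ i
  j≤i = ≮⇒≥ i≮j
  i+j≡ : i + j ≡ i ∸ j + 2 * j
  i+j≡ = trans (cong (_+ j) (sym (m∸n+n≡m j≤i))) (regroup (i ∸ j) j)
    where
    regroup : ∀ x y → x + y + y ≡ x + 2 * y
    regroup = solve-∀
  n∸2j<i∸j : n ∸ 2 * j < i ∸ j
  n∸2j<i∸j = subst (n ∸ 2 * j <_) (m+n∸n≡m (i ∸ j) (2 * j)) (∸-monoˡ-< (subst (n <_) i+j≡ n<i+j) 2j≤n)

gammaBasisCoeff-palindromic : ∀ n j {i i'} → 2 * j ≤ n → i + i' ≡ n →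
  gammaBasisCoeff n j i ≡ gammaBasisCoeff n j i'
gammaBasisCoeff-palindromic n j {i} {i'} 2j≤n i+i'≡n with i <? j | i' <? j
... | yes i<j | _ = trans (gammaBasisCoeff-< n j i<j) (sym (gammaBasisCoeff-vanishes n j 2j≤n n<i'+j))
  where
  n<i'+j : n < i' + j
  n<i'+j = subst₂ _<_ i+i'≡n (+-comm j i') (+-monoˡ-< i' i<j)
... | no _ | yes i'<j = trans (gammaBasisCoeff-vanishes n j 2j≤n n<i+j) (sym (gammaBasisCoeff-< n j i'<j))
  where
  n<i+j : n < i + j
  n<i+j = subst (_< i + j) i+i'≡n (+-monoʳ-< i i'<j)
... | no i≮j | no i'≮j = begin
  gammaBasisCoeff n j i             ≡⟨ gammaBasisCoeff-≥ n j (≮⇒≥ i≮j) ⟩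
  (n ∸ 2 * j) C (i ∸ j)             ≡⟨ cong (_C (i ∸ j)) n∸2j≡ ⟩
  ((i ∸ j) + (i' ∸ j)) C (i ∸ j)    ≡⟨ [m+n]Cm≡[m+n]Cn (i ∸ j) (i' ∸ j) ⟩
  ((i ∸ j) + (i' ∸ j)) C (i' ∸ j)   ≡⟨ cong (_C (i' ∸ j)) n∸2j≡ ⟨
  (n ∸ 2 * j) C (i' ∸ j)            ≡⟨ gammaBasisCoeff-≥ n j (≮⇒≥ i'≮j) ⟨
  gammaBasisCoeff n j i'            ∎
  where
  regroup : ∀ x y z → x + z + (y + z) ≡ x + y + 2 * z
  regroup = solve-∀
  n∸2j≡ : n ∸ 2 * j ≡ (i ∸ j) + (i' ∸ j)
  n∸2j≡ = begin
    n ∸ 2 * j                                 ≡⟨ cong (_∸ 2 * j) i+i'≡n ⟨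
    i + i' ∸ 2 * j                            ≡⟨ cong₂ (λ x y → x + y ∸ 2 * j) (m∸n+n≡m (≮⇒≥ i≮j)) (m∸n+n≡m (≮⇒≥ i'≮j)) ⟨
    (i ∸ j) + j + ((i' ∸ j) + j) ∸ 2 * j      ≡⟨ cong (_∸ 2 * j) (regroup (i ∸ j) (i' ∸ j) j) ⟩
    (i ∸ j) + (i' ∸ j) + 2 * j ∸ 2 * j        ≡⟨ m+n∸n≡m _ (2 * j) ⟩
    (i ∸ j) + (i' ∸ j)                        ∎

gammaBasisCoeff-increasing : ∀ n j {i} → 2 * i < n → gammaBasisCoeff n j i ≤ gammaBasisCoeff n j (suc i)
gammaBasisCoeff-increasing n j {i} 2i<n with i <? j
... | yes i<j = ≤-trans (≤-reflexive (gammaBasisCoeff-< n j i<j)) z≤n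
... | no i≮j  = subst₂ _≤_ (sym (gammaBasisCoeff-≥ n j j≤i))
  (trans (cong ((n ∸ 2 * j) C_) (sym (+-∸-assoc 1 j≤i))) (sym (gammaBasisCoeff-≥ n j (m≤n⇒m≤1+n j≤i))))
  (nCk≤nC[1+k] (m+n≤o⇒m≤o∸n (suc (2 * (i ∸ j))) (subst (λ x → suc x ≤ n) 2i≡ 2i<n)))
  where
  j≤i : j ≤ i
  j≤i = ≮⇒≥ i≮j
  2i≡ : 2 * i ≡ 2 * (i ∸ j) + 2 * j
  2i≡ = trans (cong (2 *_) (sym (m∸n+n≡m j≤i))) (*-distribˡ-+ 2 (i ∸ j) j)

ΣFin-cong : ∀ m {f g : Fin m → ℕ} → (∀ j → f j ≡ g j) → ΣFin m f ≡ ΣFin m g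
ΣFin-cong zero    f≡g = refl
ΣFin-cong (suc m) f≡g = cong₂ _+_ (f≡g Fin.zero) (ΣFin-cong m (f≡g ∘ Fin.suc))

ΣFin-mono-≤ : ∀ m {f g : Fin m → ℕ} → (∀ j → f j ≤ g j) → ΣFin m f ≤ ΣFin m g
ΣFin-mono-≤ zero    f≤g = z≤n
ΣFin-mono-≤ (suc m) f≤g = +-mono-≤ (f≤g Fin.zero) (ΣFin-mono-≤ m (f≤g ∘ Fin.suc))

ΣFin-toℕ : ∀ m f → ΣFin m (f ∘ toℕ) ≡ ∑< m f
ΣFin-toℕ zero    f = refl
ΣFin-toℕ (suc m) f = cong (f 0 +_) (ΣFin-toℕ m (f ∘ suc))

module _ {n} {h : ℕ → ℕ} (γ⁺ : GammaPositive n h) where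

  open Σ γ⁺ renaming (proj₁ to γ; proj₂ to h≡)

  gammaPositive⇒palindromic : Palindromic n h
  gammaPositive⇒palindromic i i≤n = begin
    h i
      ≡⟨ h≡ i ⟩
    ΣFin (suc (n / 2)) (λ j → γ j * gammaBasisCoeff n (toℕ j) i)
      ≡⟨ ΣFin-cong (suc (n / 2)) (λ j → cong (γ j *_)
           (gammaBasisCoeff-palindromic n (toℕ j) {i} {n ∸ i} (m≤n/2⇒2m≤n (toℕ≤pred[n] j)) (m+[n∸m]≡n i≤n))) ⟩
    ΣFin (suc (n / 2)) (λ j → γ j * gammaBasisCoeff n (toℕ j) (n ∸ i))
      ≡⟨ h≡ (n ∸ i) ⟨
    h (n ∸ i) ∎

  gammaPositive-increasing : ∀ {i} → 2 * i < n → h i ≤ h (suc i)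
  gammaPositive-increasing {i} 2i<n = subst₂ _≤_ (sym (h≡ i)) (sym (h≡ (suc i)))
    (ΣFin-mono-≤ (suc (n / 2)) (λ j → *-monoʳ-≤ (γ j) (gammaBasisCoeff-increasing n (toℕ j) {i} 2i<n)))

  gammaPositive⇒unimodal : Unimodal n h
  gammaPositive⇒unimodal = n / 2 , m/n≤m n 2 , increasing , decreasing
    where
    increasing : ∀ i → i < n / 2 → h i ≤ h (suc i)
    increasing i i<n/2 = gammaPositive-increasing (<-≤-trans (*-monoʳ-< 2 (n<1+n i)) (m≤n/2⇒2m≤n i<n/2))
    decreasing : ∀ i → n / 2 ≤ i → i < n → h (suc i) ≤ h i
    decreasing i n/2≤i i<n = subst₂ _≤_
      (sym (gammaPositive⇒palindromic (suc i) i<n))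
      (trans (cong h (sym (+-∸-assoc 1 i<n))) (sym (gammaPositive⇒palindromic i (<⇒≤ i<n))))
      (gammaPositive-increasing (2[n∸m]<n (n/2<m⇒n<2m (s≤s n/2≤i)) i<n))

-- Counting the lattice points of Q_{n,k}

length-filterᵇ-++ : ∀ (p : A → Bool) xs ys →
  length (filterᵇ p (xs ++ ys)) ≡ length (filterᵇ p xs) + length (filterᵇ p ys)
length-filterᵇ-++ p xs ys = trans (cong length (filter-++ (T? ∘ p) xs ys)) (length-++ (filterᵇ p xs))

length-filterᵇ-cong : ∀ {p q : A → Bool} xs → (∀ x → p x ≡ q x) →
  length (filterᵇ p xs) ≡ length (filterᵇ q xs)
length-filterᵇ-cong {p = p} {q} xs p≡q =
  cong length (filter-≐ (T? ∘ p) (T? ∘ q) ((λ {x} → subst T (p≡q x)) , (λ {x} → subst T (sym (p≡q x)))) xs)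

length-filterᵇ-none : ∀ {p : A → Bool} xs → (∀ x → p x ≡ false) → length (filterᵇ p xs) ≡ 0
length-filterᵇ-none {p = p} xs none = cong length (filter-none (T? ∘ p) (universal (λ x → subst T (none x)) xs))

length-filterᵇ-applyUpTo : ∀ (p : A → Bool) f m →
  length (filterᵇ p (applyUpTo f m)) ≡ ∑< m (λ a → length (filterᵇ p [ f a ]))
length-filterᵇ-applyUpTo p f zero    = refl
length-filterᵇ-applyUpTo p f (suc m) = trans
  (length-filterᵇ-++ p [ f 0 ] (applyUpTo (f ∘ suc) m))
  (cong (length (filterᵇ p [ f 0 ]) +_) (length-filterᵇ-applyUpTo p (f ∘ suc) m))

length-filterᵇ-[∘] : ∀ (p : B → Bool) (f : A → B) x →
  length (filterᵇ p [ f x ]) ≡ length (filterᵇ (p ∘ f) [ x ])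
length-filterᵇ-[∘] p f x with p (f x)
... | true  = refl
... | false = refl

length-filterᵇ-prepend : ∀ {n} (p : Vec ℕ (suc n) → Bool) m (vs : List (Vec ℕ n)) →
  length (filterᵇ p (concatMap (λ v → map (_∷ v) (upTo m)) vs))
    ≡ ∑< m (λ a → length (filterᵇ (p ∘ (a ∷_)) vs))
length-filterᵇ-prepend p m []       = sym (∑<-zero m (λ _ → refl))
length-filterᵇ-prepend p m (v ∷ vs) = begin
  length (filterᵇ p (map (_∷ v) (upTo m) ++ concatMap (λ v → map (_∷ v) (upTo m)) vs))
    ≡⟨ length-filterᵇ-++ p (map (_∷ v) (upTo m)) _ ⟩
  length (filterᵇ p (map (_∷ v) (upTo m))) + length (filterᵇ p (concatMap (λ v → map (_∷ v) (upTo m)) vs))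
    ≡⟨ cong₂ _+_ (trans (cong (length ∘ filterᵇ p) (map-applyUpTo id (_∷ v) m)) (trans (length-filterᵇ-applyUpTo p (_∷ v) m)
                   (∑<-cong m (λ a _ → length-filterᵇ-[∘] p (a ∷_) v))))
                 (length-filterᵇ-prepend p m vs) ⟩
  ∑< m (λ a → length (filterᵇ (p ∘ (a ∷_)) [ v ])) + ∑< m (λ a → length (filterᵇ (p ∘ (a ∷_)) vs))
    ≡⟨ ∑<-distrib-+ m (λ a → length (filterᵇ (p ∘ (a ∷_)) [ v ])) (λ a → length (filterᵇ (p ∘ (a ∷_)) vs)) ⟨
  ∑< m (λ a → length (filterᵇ (p ∘ (a ∷_)) [ v ]) + length (filterᵇ (p ∘ (a ∷_)) vs))
    ≡⟨ ∑<-cong m (λ a _ → length-filterᵇ-++ (p ∘ (a ∷_)) [ v ] vs) ⟨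
  ∑< m (λ a → length (filterᵇ (p ∘ (a ∷_)) (v ∷ vs))) ∎

length-filterᵇ-boxVecs-suc : ∀ n b (p : Vec ℕ (suc n) → Bool) →
  length (filterᵇ p (boxVecs (suc n) b)) ≡ ∑< (suc b) (λ a → length (filterᵇ (p ∘ (a ∷_)) (boxVecs n b)))
length-filterᵇ-boxVecs-suc n b p = length-filterᵇ-prepend p (suc b) (boxVecs n b)

<ᵇ-suc : ∀ x m → (x <ᵇ suc m) ≡ (x ≤ᵇ m)
<ᵇ-suc zero    m = refl
<ᵇ-suc (suc x) m = refl

+-≤ᵇ-fits : ∀ {x m} y → x ≤ m → (x + y ≤ᵇ m) ≡ (y ≤ᵇ m ∸ x)
+-≤ᵇ-fits y z≤n                 = refl
+-≤ᵇ-fits {suc x} {suc m} y (s≤s x≤m) = trans (<ᵇ-suc (x + y) m) (+-≤ᵇ-fits y x≤m)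

+-≤ᵇ-exceeds : ∀ {x m} y → m < x → (x + y ≤ᵇ m) ≡ false
+-≤ᵇ-exceeds {suc x} {zero}  y _         = refl
+-≤ᵇ-exceeds {suc x} {suc m} y (s≤s m<x) = trans (<ᵇ-suc (x + y) m) (+-≤ᵇ-exceeds y m<x)

lowBounded-suc : ∀ {n} k j (v : Vec ℕ n) → lowBounded k (suc j) v ≡ lowBounded (pred k) j v
lowBounded-suc k       j []      = refl
lowBounded-suc zero    j (a ∷ v) = cong (true ∧_) (lowBounded-suc zero (suc j) v)
lowBounded-suc (suc k) j (a ∷ v) = cong (_ ∧_) (lowBounded-suc (suc k) (suc j) v)

isPoint : ∀ {n} → ℕ → ℕ → ℕ → Vec ℕ n → Bool
isPoint k m i x = (lowBounded k 0 x ∧ (vsum x ≤ᵇ m)) ∧ (nonzeros x ≡ᵇ i)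

-- hCoeff n k i is countPoints n n k n i by definition; the box size b and the bound m on the
-- coordinate sum are separated from the dimension n so that they can vary in the induction on n.
countPoints : (n b k m i : ℕ) → ℕ
countPoints n b k m i = length (filterᵇ (isPoint k m i) (boxVecs n b))

isPoint-0∷ : ∀ {n} k m i (v : Vec ℕ n) → isPoint k m i (0 ∷ v) ≡ isPoint (pred k) m i v
isPoint-0∷ zero    m i v = cong (λ l → (l ∧ (vsum v ≤ᵇ m)) ∧ (nonzeros v ≡ᵇ i)) (lowBounded-suc 0 0 v)
isPoint-0∷ (suc k) m i v = cong (λ l → (l ∧ (vsum v ≤ᵇ m)) ∧ (nonzeros v ≡ᵇ i)) (lowBounded-suc (suc k) 0 v)

isPoint-∷-nonzeros≡0 : ∀ {n} k m a (v : Vec ℕ n) → isPoint k m 0 (suc a ∷ v) ≡ false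
isPoint-∷-nonzeros≡0 k m a v = ∧-zeroʳ _

isPoint-∷-exceeds : ∀ {n} k {m} i {x} (v : Vec ℕ n) → m < x → isPoint k m i (x ∷ v) ≡ false
isPoint-∷-exceeds k i {x} v m<x
  rewrite +-≤ᵇ-exceeds (vsum v) m<x | ∧-zeroʳ (lowBounded k 0 (x ∷ v)) = refl

isPoint-1∷ : ∀ {n} k m i (v : Vec ℕ n) → isPoint (suc k) (suc m) (suc i) (1 ∷ v) ≡ isPoint k m i v
isPoint-1∷ k m i v = cong₂ (λ l s → (l ∧ s) ∧ (nonzeros v ≡ᵇ i)) (lowBounded-suc (suc k) 0 v) (<ᵇ-suc (vsum v) m)

isPoint-2+∷ : ∀ {n} k m i a (v : Vec ℕ n) → isPoint (suc k) m i (suc (suc a) ∷ v) ≡ false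
isPoint-2+∷ k m i a v = refl

isPoint-free-∷ : ∀ {n} m i {x} (v : Vec ℕ n) → suc x ≤ m →
  isPoint 0 m (suc i) (suc x ∷ v) ≡ isPoint 0 (m ∸ suc x) i v
isPoint-free-∷ m i v x<m =
  cong₂ (λ l s → (l ∧ s) ∧ (nonzeros v ≡ᵇ i)) (lowBounded-suc 0 0 v) (+-≤ᵇ-fits (vsum v) x<m)

-- a of the k coordinates bounded by 1 equal 1; the other i ∸ a nonzero coordinates are chosen
-- among the r free ones, and as positive integers with sum ≤ m ∸ a they number C(m ∸ a, i ∸ a).
countFormula : (k r m i : ℕ) → ℕ
countFormula k r m i = ∑< (suc i) (λ a → (k C a) * ((r C (i ∸ a)) * ((m ∸ a) C (i ∸ a))))

countFormula-free : ∀ r m i → countFormula 0 r m i ≡ (r C i) * (m C i)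
countFormula-free r m i = trans (cong₂ _+_ (*-identityˡ _) (∑<-zero i (λ _ → refl))) (+-identityʳ _)

countFormula-suc : ∀ k r m i →
  countFormula (suc k) r (suc m) (suc i) ≡ countFormula k r (suc m) (suc i) + countFormula k r m i
countFormula-suc k r m i = begin
  1 * X + ∑< (suc i) (λ a → (suc k C suc a) * Y a)
    ≡⟨ cong (1 * X +_) (trans (∑<-cong (suc i) (λ a _ → pascal-term a)) (∑<-distrib-+ (suc i) lower upper)) ⟩
  1 * X + (countFormula k r m i + ∑< (suc i) upper)
    ≡⟨ regroup (1 * X) (countFormula k r m i) (∑< (suc i) upper) ⟩
  countFormula k r (suc m) (suc i) + countFormula k r m i ∎
  where
  X : ℕ
  X = (r C suc i) * (suc m C suc i)
  Y lower upper : ℕ → ℕ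
  Y a = (r C (i ∸ a)) * ((m ∸ a) C (i ∸ a))
  lower a = (k C a) * Y a
  upper a = (k C suc a) * Y a
  pascal-term : ∀ a → (suc k C suc a) * Y a ≡ lower a + upper a
  pascal-term a = trans (cong (_* Y a) (pascal k a)) (*-distribʳ-+ (Y a) (k C a) (k C suc a))
  regroup : ∀ x y z → x + (y + z) ≡ x + z + y
  regroup = solve-∀

countPoints-free : ∀ n {b m} i → m ≤ b → countPoints n b 0 m i ≡ (n C i) * (m C i)
countPoints-free zero    zero    m≤b = refl
countPoints-free zero    (suc i) m≤b = refl
countPoints-free (suc n) {b} {m} i m≤b = begin
  countPoints (suc n) b 0 m i
    ≡⟨ length-filterᵇ-boxVecs-suc n b (isPoint 0 m i) ⟩
  zeroHead i + ∑< b (positiveHead i)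
    ≡⟨ cong (_+ ∑< b (positiveHead i)) (trans (length-filterᵇ-cong (boxVecs n b) (isPoint-0∷ 0 m i)) (countPoints-free n i m≤b)) ⟩
  (n C i) * (m C i) + ∑< b (positiveHead i)
    ≡⟨ positive-heads i ⟩
  (suc n C i) * (m C i) ∎
  where
  zeroHead : ℕ → ℕ
  zeroHead i = length (filterᵇ (isPoint 0 m i ∘ (0 ∷_)) (boxVecs n b))
  positiveHead : ℕ → ℕ → ℕ
  positiveHead i a = length (filterᵇ (isPoint 0 m i ∘ (suc a ∷_)) (boxVecs n b))
  positive-heads : ∀ i → (n C i) * (m C i) + ∑< b (positiveHead i) ≡ (suc n C i) * (m C i)
  positive-heads zero = trans
    (cong (1 * (m C 0) +_) (∑<-zero b (λ a → length-filterᵇ-none (boxVecs n b) (isPoint-∷-nonzeros≡0 0 m a))))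
    (+-identityʳ _)
  positive-heads (suc i) = begin
    (n C suc i) * (m C suc i) + ∑< b (positiveHead (suc i))
      ≡⟨ cong ((n C suc i) * (m C suc i) +_) positive-sum ⟩
    (n C suc i) * (m C suc i) + (n C i) * (m C suc i)
      ≡⟨ +-comm ((n C suc i) * (m C suc i)) _ ⟩
    (n C i) * (m C suc i) + (n C suc i) * (m C suc i)
      ≡⟨ *-distribʳ-+ (m C suc i) (n C i) (n C suc i) ⟨
    (n C i + n C suc i) * (m C suc i)
      ≡⟨ cong (_* (m C suc i)) (pascal n i) ⟨
    (suc n C suc i) * (m C suc i) ∎
    where
    exceeds : ∀ a → m ≤ a → positiveHead (suc i) a ≡ 0
    exceeds a m≤a = length-filterᵇ-none (boxVecs n b) (λ v → isPoint-∷-exceeds 0 (suc i) v (s≤s m≤a))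
    positive-sum : ∑< b (positiveHead (suc i)) ≡ (n C i) * (m C suc i)
    positive-sum = begin
      ∑< b (positiveHead (suc i))
        ≡⟨ ∑<-support b m (λ a b≤a → exceeds a (≤-trans m≤b b≤a)) exceeds ⟩
      ∑< m (positiveHead (suc i))
        ≡⟨ ∑<-cong m (λ a a<m → trans (length-filterᵇ-cong (boxVecs n b) (λ v → isPoint-free-∷ m i v a<m))
                                       (countPoints-free n i (≤-trans (m∸n≤m m (suc a)) m≤b))) ⟩
      ∑< m (λ a → (n C i) * ((m ∸ suc a) C i))
        ≡⟨ *-distribˡ-∑< m (n C i) (λ a → (m ∸ suc a) C i) ⟨
      (n C i) * ∑< m (λ a → (m ∸ suc a) C i)
        ≡⟨ cong ((n C i) *_) (∑<[m∸1+a]Ci≡mC[1+i] m i) ⟩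
      (n C i) * (m C suc i) ∎

-- k ≤ m keeps m ∸ a in countFormula from truncating for every a with C(k, a) ≠ 0.
countPoints≡countFormula : ∀ n {b} k {m} i → k ≤ n → k ≤ m → m ≤ b →
  countPoints n b k m i ≡ countFormula k (n ∸ k) m i
countPoints≡countFormula n zero i _ _ m≤b = trans (countPoints-free n i m≤b) (sym (countFormula-free n _ i))
countPoints≡countFormula (suc n) {suc b} (suc k) {suc m} i (s≤s k≤n) (s≤s k≤m) (s≤s m≤b) = begin
  countPoints (suc n) (suc b) (suc k) (suc m) i
    ≡⟨ length-filterᵇ-boxVecs-suc n (suc b) (isPoint (suc k) (suc m) i) ⟩
  head 0 + (head 1 + ∑< b (head ∘ suc ∘ suc))
    ≡⟨ cong₂ (λ x y → x + (head 1 + y))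
         (trans (length-filterᵇ-cong (boxVecs n (suc b)) (isPoint-0∷ (suc k) (suc m) i))
                (countPoints≡countFormula n k i k≤n (m≤n⇒m≤1+n k≤m) (s≤s m≤b)))
         (∑<-zero b (λ a → length-filterᵇ-none (boxVecs n (suc b)) (isPoint-2+∷ k (suc m) i a))) ⟩
  countFormula k (n ∸ k) (suc m) i + (oneHead i + 0)
    ≡⟨ one-heads i ⟩
  countFormula (suc k) (n ∸ k) (suc m) i ∎
  where
  head : ℕ → ℕ
  head x = length (filterᵇ (isPoint (suc k) (suc m) i ∘ (x ∷_)) (boxVecs n (suc b)))
  oneHead : ℕ → ℕ
  oneHead i = length (filterᵇ (isPoint (suc k) (suc m) i ∘ (1 ∷_)) (boxVecs n (suc b)))
  one-heads : ∀ i → countFormula k (n ∸ k) (suc m) i + (oneHead i + 0) ≡ countFormula (suc k) (n ∸ k) (suc m) i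
  one-heads zero = trans
    (cong (λ x → countFormula k (n ∸ k) (suc m) 0 + (x + 0))
          (length-filterᵇ-none (boxVecs n (suc b)) (isPoint-∷-nonzeros≡0 (suc k) (suc m) 0)))
    (+-identityʳ _)
  one-heads (suc i) = begin
    countFormula k (n ∸ k) (suc m) (suc i) + (oneHead (suc i) + 0)
      ≡⟨ cong (countFormula k (n ∸ k) (suc m) (suc i) +_) (trans (+-identityʳ _)
           (trans (length-filterᵇ-cong (boxVecs n (suc b)) (isPoint-1∷ k m i))
                  (countPoints≡countFormula n k i k≤n k≤m (m≤n⇒m≤1+n m≤b)))) ⟩
    countFormula k (n ∸ k) (suc m) (suc i) + countFormula k (n ∸ k) m i
      ≡⟨ countFormula-suc k (n ∸ k) m i ⟨
    countFormula (suc k) (n ∸ k) (suc m) (suc i) ∎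

-- The γ-expansion of h(τ_{n,k}, t)

countFormula-regroup : ∀ k r i →
  countFormula k r (k + r) i ≡ ∑< (suc i) (λ p → (k C p) * (r C (i ∸ p)) * ((p + r) C i))
countFormula-regroup k r i = begin
  countFormula k r (k + r) i
    ≡⟨ ∑<-cong (suc i) (λ a _ → expand a) ⟩
  ∑< (suc i) (λ a → ∑< (suc (i ∸ a)) (λ c → g a (a + c)))
    ≡⟨ ∑<-triangle i g ⟩
  ∑< (suc i) (λ p → ∑< (suc p) (λ a → g a p))
    ≡⟨ ∑<-cong (suc i) (λ p p<1+i → collapse p (s≤s⁻¹ p<1+i)) ⟩
  ∑< (suc i) (λ p → (k C p) * (r C (i ∸ p)) * ((p + r) C i)) ∎
  where
  g : ℕ → ℕ → ℕ
  g a p = (k C p) * (r C (i ∸ p)) * ((p C a) * (r C (i ∸ a)))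
  shuffle : ∀ x y z w → x * y * (z * w) ≡ x * z * (w * y)
  shuffle = solve-∀
  interchange : ∀ x y z w → x * y * (z * w) ≡ x * z * (y * w)
  interchange = solve-∀
  expand : ∀ a →
    (k C a) * ((r C (i ∸ a)) * ((k + r ∸ a) C (i ∸ a))) ≡ ∑< (suc (i ∸ a)) (λ c → g a (a + c))
  expand a with a ≤? k
  ... | yes a≤k = begin
    (k C a) * ((r C (i ∸ a)) * ((k + r ∸ a) C (i ∸ a)))
      ≡⟨ *-assoc (k C a) (r C (i ∸ a)) _ ⟨
    (k C a) * (r C (i ∸ a)) * ((k + r ∸ a) C (i ∸ a))
      ≡⟨ cong (λ x → (k C a) * (r C (i ∸ a)) * (x C (i ∸ a))) (+-∸-comm r a≤k) ⟩
    (k C a) * (r C (i ∸ a)) * ((k ∸ a + r) C (i ∸ a))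
      ≡⟨ cong ((k C a) * (r C (i ∸ a)) *_) (vandermonde (k ∸ a) r (i ∸ a)) ⟨
    (k C a) * (r C (i ∸ a)) * ∑< (suc (i ∸ a)) rest
      ≡⟨ *-distribˡ-∑< (suc (i ∸ a)) ((k C a) * (r C (i ∸ a))) rest ⟩
    ∑< (suc (i ∸ a)) (λ c → (k C a) * (r C (i ∸ a)) * rest c)
      ≡⟨ ∑<-cong (suc (i ∸ a)) (λ c _ → revise c) ⟩
    ∑< (suc (i ∸ a)) (λ c → g a (a + c)) ∎
    where
    rest : ℕ → ℕ
    rest c = ((k ∸ a) C c) * (r C (i ∸ a ∸ c))
    revise : ∀ c → (k C a) * (r C (i ∸ a)) * rest c ≡ g a (a + c)
    revise c = begin
      (k C a) * (r C (i ∸ a)) * (((k ∸ a) C c) * (r C (i ∸ a ∸ c)))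
        ≡⟨ shuffle (k C a) (r C (i ∸ a)) ((k ∸ a) C c) (r C (i ∸ a ∸ c)) ⟩
      (k C a) * ((k ∸ a) C c) * ((r C (i ∸ a ∸ c)) * (r C (i ∸ a)))
        ≡⟨ cong₂ (λ x y → x * ((r C y) * (r C (i ∸ a)))) (nCa*[n∸a]Cc≡nC[a+c]*[a+c]Ca k a c) (∸-+-assoc i a c) ⟩
      (k C (a + c)) * ((a + c) C a) * ((r C (i ∸ (a + c))) * (r C (i ∸ a)))
        ≡⟨ interchange (k C (a + c)) ((a + c) C a) (r C (i ∸ (a + c))) (r C (i ∸ a)) ⟩
      g a (a + c) ∎
  ... | no a≰k = trans
    (cong (λ x → x * ((r C (i ∸ a)) * ((k + r ∸ a) C (i ∸ a)))) (k>n⇒nCk≡0 (≰⇒> a≰k)))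
    (sym (∑<-zero (suc (i ∸ a)) (λ c → cong (λ x → x * (r C (i ∸ (a + c))) * (((a + c) C a) * (r C (i ∸ a))))
                                                (k>n⇒nCk≡0 (<-≤-trans (≰⇒> a≰k) (m≤m+n a c))))))
  collapse : ∀ p → p ≤ i → ∑< (suc p) (λ a → g a p) ≡ (k C p) * (r C (i ∸ p)) * ((p + r) C i)
  collapse p p≤i = begin
    ∑< (suc p) (λ a → g a p)
      ≡⟨ *-distribˡ-∑< (suc p) ((k C p) * (r C (i ∸ p))) (λ a → (p C a) * (r C (i ∸ a))) ⟨
    (k C p) * (r C (i ∸ p)) * ∑< (suc p) (λ a → (p C a) * (r C (i ∸ a)))
      ≡⟨ cong ((k C p) * (r C (i ∸ p)) *_) (∑<-support (suc p) (suc i) vanish (λ a i<a → vanish a (≤-trans (s≤s p≤i) i<a))) ⟩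
    (k C p) * (r C (i ∸ p)) * ∑< (suc i) (λ a → (p C a) * (r C (i ∸ a)))
      ≡⟨ cong ((k C p) * (r C (i ∸ p)) *_) (vandermonde p r i) ⟩
    (k C p) * (r C (i ∸ p)) * ((p + r) C i) ∎
    where
    vanish : ∀ a → suc p ≤ a → (p C a) * (r C (i ∸ a)) ≡ 0
    vanish a p<a = cong (_* (r C (i ∸ a))) (k>n⇒nCk≡0 p<a)

γ-terms-regroup : ∀ k r i →
  ∑< (suc i) (λ j → (r C j) * (i C j) * ((k + r ∸ j) C i))
    ≡ ∑< (suc i) (λ p → (k C p) * (r C (i ∸ p)) * ((p + r) C i))
γ-terms-regroup k r i = begin
  ∑< (suc i) (λ j → (r C j) * (i C j) * ((k + r ∸ j) C i))
    ≡⟨ ∑<-cong (suc i) (λ j _ → expand j) ⟩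
  ∑< (suc i) (λ j → ∑< (suc i) (λ p → g j p))
    ≡⟨ ∑<-comm (suc i) (suc i) g ⟩
  ∑< (suc i) (λ p → ∑< (suc i) (λ j → g j p))
    ≡⟨ ∑<-cong (suc i) (λ p p<1+i → collapse p (s≤s⁻¹ p<1+i)) ⟩
  ∑< (suc i) (λ p → (k C p) * (r C (i ∸ p)) * ((p + r) C i)) ∎
  where
  g : ℕ → ℕ → ℕ
  g j p = (r C j) * (i C j) * ((k C p) * ((r ∸ j) C (i ∸ p)))
  expand : ∀ j → (r C j) * (i C j) * ((k + r ∸ j) C i) ≡ ∑< (suc i) (g j)
  expand j with j ≤? r
  ... | yes j≤r = begin
    (r C j) * (i C j) * ((k + r ∸ j) C i)
      ≡⟨ cong (λ x → (r C j) * (i C j) * (x C i)) (+-∸-assoc k j≤r) ⟩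
    (r C j) * (i C j) * ((k + (r ∸ j)) C i)
      ≡⟨ cong ((r C j) * (i C j) *_) (vandermonde k (r ∸ j) i) ⟨
    (r C j) * (i C j) * ∑< (suc i) (λ p → (k C p) * ((r ∸ j) C (i ∸ p)))
      ≡⟨ *-distribˡ-∑< (suc i) ((r C j) * (i C j)) (λ p → (k C p) * ((r ∸ j) C (i ∸ p))) ⟩
    ∑< (suc i) (g j) ∎
  ... | no j≰r = trans
    (cong (λ x → x * (i C j) * ((k + r ∸ j) C i)) rCj≡0)
    (sym (∑<-zero (suc i) (λ p → cong (λ x → x * (i C j) * ((k C p) * ((r ∸ j) C (i ∸ p)))) rCj≡0)))
    where
    rCj≡0 : r C j ≡ 0
    rCj≡0 = k>n⇒nCk≡0 (≰⇒> j≰r)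
  collapse : ∀ p → p ≤ i → ∑< (suc i) (λ j → g j p) ≡ (k C p) * (r C (i ∸ p)) * ((p + r) C i)
  collapse p p≤i = begin
    ∑< (suc i) (λ j → g j p)
      ≡⟨ ∑<-cong (suc i) (λ j _ → swap-chosen j) ⟩
    ∑< (suc i) (λ j → (k C p) * (r C s) * (((r ∸ s) C j) * (i C j)))
      ≡⟨ *-distribˡ-∑< (suc i) ((k C p) * (r C s)) (λ j → ((r ∸ s) C j) * (i C j)) ⟨
    (k C p) * (r C s) * ∑< (suc i) (λ j → ((r ∸ s) C j) * (i C j))
      ≡⟨ cong ((k C p) * (r C s) *_) (∑mCj*iCj≡[m+i]Ci (r ∸ s) i) ⟩
    (k C p) * (r C s) * ((r ∸ s + i) C i)
      ≡⟨ top ⟩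
    (k C p) * (r C s) * ((p + r) C i) ∎
    where
    s : ℕ
    s = i ∸ p
    swap-chosen : ∀ j → g j p ≡ (k C p) * (r C s) * (((r ∸ s) C j) * (i C j))
    swap-chosen j = begin
      (r C j) * (i C j) * ((k C p) * ((r ∸ j) C s))
        ≡⟨ rearrangeˡ (r C j) (i C j) (k C p) ((r ∸ j) C s) ⟩
      (k C p) * ((r C j) * ((r ∸ j) C s)) * (i C j)
        ≡⟨ cong (λ x → (k C p) * x * (i C j)) (nCj*[n∸j]Cs≡nCs*[n∸s]Cj r j s) ⟩
      (k C p) * ((r C s) * ((r ∸ s) C j)) * (i C j)
        ≡⟨ rearrangeʳ (k C p) (r C s) ((r ∸ s) C j) (i C j) ⟩
      (k C p) * (r C s) * (((r ∸ s) C j) * (i C j)) ∎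
      where
      rearrangeˡ : ∀ x y z w → x * y * (z * w) ≡ z * (x * w) * y
      rearrangeˡ = solve-∀
      rearrangeʳ : ∀ x y z w → x * (y * z) * w ≡ x * y * (z * w)
      rearrangeʳ = solve-∀
    top : (k C p) * (r C s) * ((r ∸ s + i) C i) ≡ (k C p) * (r C s) * ((p + r) C i)
    top with s ≤? r
    ... | yes s≤r = cong (λ x → (k C p) * (r C s) * (x C i)) (begin
      r ∸ s + i        ≡⟨ cong (r ∸ s +_) (trans (sym (m+[n∸m]≡n p≤i)) (+-comm p s)) ⟩
      r ∸ s + (s + p)  ≡⟨ +-assoc (r ∸ s) s p ⟨
      r ∸ s + s + p    ≡⟨ cong (_+ p) (m∸n+n≡m s≤r) ⟩
      r + p            ≡⟨ +-comm r p ⟩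
      p + r            ∎)
    ... | no s≰r = trans (vanishes _) (sym (vanishes _))
      where
      vanishes : ∀ x → (k C p) * (r C s) * x ≡ 0
      vanishes x = cong (_* x) (trans (cong ((k C p) *_) (k>n⇒nCk≡0 (≰⇒> s≰r))) (*-zeroʳ (k C p)))

gammaCoeff : (r n j : ℕ) → ℕ
gammaCoeff r n j = (r C j) * ((n ∸ j) C j)

gammaCoeff*gammaBasisCoeff : ∀ r n {i j} → j ≤ i →
  gammaCoeff r n j * gammaBasisCoeff n j i ≡ (r C j) * (i C j) * ((n ∸ j) C i)
gammaCoeff*gammaBasisCoeff r n {i} {j} j≤i = begin
  (r C j) * ((n ∸ j) C j) * gammaBasisCoeff n j i
    ≡⟨ cong ((r C j) * ((n ∸ j) C j) *_) (gammaBasisCoeff-≥ n j j≤i) ⟩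
  (r C j) * ((n ∸ j) C j) * ((n ∸ 2 * j) C (i ∸ j))
    ≡⟨ cong (λ x → (r C j) * ((n ∸ j) C j) * (x C (i ∸ j))) n∸2j≡ ⟩
  (r C j) * ((n ∸ j) C j) * ((n ∸ j ∸ j) C (i ∸ j))
    ≡⟨ *-assoc (r C j) _ _ ⟩
  (r C j) * (((n ∸ j) C j) * ((n ∸ j ∸ j) C (i ∸ j)))
    ≡⟨ cong ((r C j) *_) (nCa*[n∸a]Cc≡nC[a+c]*[a+c]Ca (n ∸ j) j (i ∸ j)) ⟩
  (r C j) * (((n ∸ j) C (j + (i ∸ j))) * ((j + (i ∸ j)) C j))
    ≡⟨ cong (λ x → (r C j) * (((n ∸ j) C x) * (x C j))) (m+[n∸m]≡n j≤i) ⟩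
  (r C j) * (((n ∸ j) C i) * (i C j))
    ≡⟨ rearrange (r C j) ((n ∸ j) C i) (i C j) ⟩
  (r C j) * (i C j) * ((n ∸ j) C i) ∎
  where
  n∸2j≡ : n ∸ 2 * j ≡ n ∸ j ∸ j
  n∸2j≡ = trans (cong (λ x → n ∸ (j + x)) (+-identityʳ j)) (sym (∸-+-assoc n j j))
  rearrange : ∀ x y z → x * (y * z) ≡ x * z * y
  rearrange = solve-∀

hCoeff-gammaExpansion : ∀ k r i → hCoeff (k + r) k i
  ≡ ΣFin (suc ((k + r) / 2)) (λ j → gammaCoeff r (k + r) (toℕ j) * gammaBasisCoeff (k + r) (toℕ j) i)
hCoeff-gammaExpansion k r i = begin
  hCoeff n k i
    ≡⟨ countPoints≡countFormula n k i (m≤m+n k r) (m≤m+n k r) ≤-refl ⟩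
  countFormula k (n ∸ k) n i
    ≡⟨ cong (λ ρ → countFormula k ρ n i) (m+n∸m≡n k r) ⟩
  countFormula k r n i
    ≡⟨ countFormula-regroup k r i ⟩
  ∑< (suc i) (λ p → (k C p) * (r C (i ∸ p)) * ((p + r) C i))
    ≡⟨ γ-terms-regroup k r i ⟨
  ∑< (suc i) (λ j → (r C j) * (i C j) * ((n ∸ j) C i))
    ≡⟨ ∑<-cong (suc i) (λ j j<1+i → gammaCoeff*gammaBasisCoeff r n (s≤s⁻¹ j<1+i)) ⟨
  ∑< (suc i) term
    ≡⟨ ∑<-support (suc i) (suc (n / 2)) above-i above-n/2 ⟩
  ∑< (suc (n / 2)) term
    ≡⟨ ΣFin-toℕ (suc (n / 2)) term ⟨
  ΣFin (suc (n / 2)) (term ∘ toℕ) ∎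
  where
  n : ℕ
  n = k + r
  term : ℕ → ℕ
  term j = gammaCoeff r n j * gammaBasisCoeff n j i
  above-i : ∀ j → suc i ≤ j → term j ≡ 0
  above-i j i<j = trans (cong (gammaCoeff r n j *_) (gammaBasisCoeff-< n j i<j)) (*-zeroʳ (gammaCoeff r n j))
  above-n/2 : ∀ j → suc (n / 2) ≤ j → term j ≡ 0
  above-n/2 j n/2<j = cong (_* gammaBasisCoeff n j i)
    (trans (cong ((r C j) *_) (k>n⇒nCk≡0 (n<2m⇒n∸m<m {j} {n} (n/2<m⇒n<2m n/2<j)))) (*-zeroʳ (r C j)))

hCoeff-gammaPositive : ∀ {n k} → k ≤ n → GammaPositive n (hCoeff n k)
hCoeff-gammaPositive {n} {k} k≤n = subst (λ n → GammaPositive n (hCoeff n k)) (m+[n∸m]≡n k≤n)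
  (gammaCoeff r (k + r) ∘ toℕ , hCoeff-gammaExpansion k r)
  where
  r : ℕ
  r = n ∸ k

theorem1p3 : (n k : ℕ) → 1 ≤ n → k ≤ n →
    GammaPositive n (hCoeff n k) × Palindromic n (hCoeff n k) × Unimodal n (hCoeff n k)
theorem1p3 n k _ k≤n = γ⁺ , gammaPositive⇒palindromic γ⁺ , gammaPositive⇒unimodal γ⁺
  where
  γ⁺ : GammaPositive n (hCoeff n k)
  γ⁺ = hCoeff-gammaPositive k≤n
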